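{- Let $G$ be a connected locally connected graph of diameter two with $n$ vertices and fewer than $n$ (distinct) lines. Then $G$ is isomorphic to $K_{1,2,2}$, $K_{2,2,2}$ or $K_{2,2,2,2}$.
   Context: A connected graph $G$ is locally connected if for every vertex $v$ the subgraph induced by its neighborhood $N(v)$ is connected. For distinct vertices $a,b$, the line $\overline{ab}$ is the set of all vertices $c$ such that some shortest path of $G$ contains $a$, $b$ and $c$. The number of lines is the number of distinct sets $\overline{ab}$ over all pairs of distinct vertices. $K_{n_1,\dots,n_k}$ denotes the complete multipartite graph with parts of sizes $n_1,\dots,n_k$. -}

module Defs where

open import Data.Nat using (ℕ; zero; suc; _≤_; _<_)
open import Data.Fin using (Fin; zero; suc; splitAt)
open import Data.Fin.Properties using () renaming (_≟_ to _≟ᶠ_)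
open import Data.List using (List; []; _∷_; length)
open import Data.Nat.ListAction using (sum)
open import Data.List.Membership.Propositional using (_∈_)
open import Data.Product using (Σ; ∃; ∃-syntax; _×_; _,_)
open import Data.Sum using (_⊎_; inj₁; inj₂)
open import Relation.Nullary using (¬_; Dec)
open import Relation.Binary.PropositionalEquality using (_≡_; _≢_)
open import Function.Bundles using (_↔_; _⇔_; Inverse)

record Graph (n : ℕ) : Set₁ where
  field
    Adj     : Fin n → Fin n → Set
    adj?    : ∀ x y → Dec (Adj x y)
    sym     : ∀ {x y} → Adj x y → Adj y x
    irrefl  : ∀ {x} → ¬ Adj x x

module _ {n : ℕ} (G : Graph n) where
  open Graph G

  data Walk : Fin n → Fin n → ℕ → Set where
    stop : ∀ x → Walk x x zero
    step : ∀ {x y z k} → Adj x y → Walk y z k → Walk x z (suc k)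

  data OnWalk (v : Fin n) : ∀ {x y k} → Walk x y k → Set where
    here-stop : OnWalk v (stop v)
    here-step : ∀ {y z k} (e : Adj v y) (w : Walk y z k) → OnWalk v (step e w)
    there     : ∀ {x y z k} (e : Adj x y) {w : Walk y z k} → OnWalk v w → OnWalk v (step e w)

  data AllOnWalk (P : Fin n → Set) : ∀ {x y k} → Walk x y k → Set where
    all-stop : ∀ {x} → P x → AllOnWalk P (stop x)
    all-step : ∀ {x y z k} {e : Adj x y} {w : Walk y z k} → P x → AllOnWalk P w → AllOnWalk P (step e w)

  IsShortest : ∀ {x y k} → Walk x y k → Set
  IsShortest {x} {y} {k} _ = ∀ {k′} → Walk x y k′ → k ≤ k′

  Connected : Set
  Connected = ∀ x y → ∃[ k ] Walk x y k

  LocallyConnected : Set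
  LocallyConnected = ∀ v u w → Adj v u → Adj v w →
    ∃[ k ] Σ (Walk u w k) (λ p → AllOnWalk (Adj v) p)

  DiameterTwo : Set
  DiameterTwo = (∀ x y → ∃[ k ] (k ≤ 2 × Walk x y k))
              × (∃[ x ] ∃[ y ] (∀ {k} → Walk x y k → 2 ≤ k))

  -- c lies on the line ab: some shortest path contains a, b and c
  InLine : Fin n → Fin n → Fin n → Set
  InLine a b c = ∃[ x ] ∃[ y ] ∃[ k ] Σ (Walk x y k) λ p →
    IsShortest p × OnWalk a p × OnWalk b p × OnWalk c p

  SameLine : Fin n → Fin n → Fin n → Fin n → Set
  SameLine a b c d = ∀ v → (InLine a b v → InLine c d v) × (InLine c d v → InLine a b v)

  -- the number of distinct lines is < m: there is a list of fewer than m pairs of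
  -- distinct vertices such that every line equals the line of some pair in the list
  FewerLinesThan : ℕ → Set
  FewerLinesThan m = ∃[ L ] (length L < m
    × (∀ {a b} → (a , b) ∈ L → a ≢ b)
    × (∀ a b → a ≢ b → ∃[ c ] ∃[ d ] ((c , d) ∈ L × SameLine a b c d)))

-- Complete multipartite graph K_{n₁,…,n_k}: vertices Fin (n₁+…+n_k), split into
-- consecutive blocks; adjacent iff in different blocks.
part : (ms : List ℕ) → Fin (sum ms) → Fin (length ms)
part []       ()
part (m ∷ ms) i with splitAt m i
... | inj₁ _ = zero
... | inj₂ j = suc (part ms j)

K : (ms : List ℕ) → Graph (sum ms)
K ms = record
  { Adj    = λ x y → part ms x ≢ part ms y
  ; adj?   = λ x y → Relation.Nullary.¬? (part ms x ≟ᶠ part ms y)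
  ; sym    = λ ne eq → ne (Relation.Binary.PropositionalEquality.sym eq)
  ; irrefl = λ ne → ne Relation.Binary.PropositionalEquality.refl
  }

_≅_ : ∀ {n m} → Graph n → Graph m → Set
_≅_ {n} {m} G H = Σ (Fin n ↔ Fin m) λ f →
  ∀ x y → Graph.Adj G x y ⇔ Graph.Adj H (Inverse.to f x) (Inverse.to f y)

-- In a graph of diameter two the line ab is {a, b} ∪ (N(a) △ N(b)) if a ∼ b and
-- {a, b} ∪ (N(a) ∩ N(b)) otherwise. Fix a centre v. By local connectivity the lines vb and
-- vb′ coincide only if b and b′ are twins in N(v), so the lines vb with b ∉ N(v) or b the
-- representative of its twin class are distinct. Every other neighbour a of v gets a line
-- containing a but missing one of its twins or, if a lies in a universal pair {a, a′}
-- (a ≁ a′, both adjacent to all other vertices), a line through a fixed vertex y; v itself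
-- gets an edge of N(v). With v and y chosen according to the universal pairs present, these
-- n lines are distinct unless G consists of pairwise adjacent universal pairs and at most
-- one further vertex. With such a vertex there are exactly two pairs, without one there are
-- three or four: five pairs contain a K₅, and two pairs form a C₄, which is not locally
-- connected.

module Submission where

open import Defs
open import Data.Nat using (ℕ; zero; suc; s≤s; z≤n) renaming (_≤_ to _≤ℕ_)
open import Data.Nat.Properties using (≤-trans)
open import Data.Fin
  using (Fin; Fin′; zero; suc; toℕ; inject; fromℕ<; splitAt; join; _↑ˡ_; _↑ʳ_) renaming (_<_ to _<ᶠ_)
open import Data.Fin.Patterns using (0F; 1F; 2F; 3F; 4F)
open import Data.Fin.Properties
  using ( suc-injective; toℕ-injective; toℕ-inject; toℕ-fromℕ<; splitAt-↑ˡ; splitAt-↑ʳ; join-splitAt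
        ; pigeonhole; <-irrefl; <-cmp; any?; all?; ¬∀⟶∃¬; ¬∀⟶∃¬-smallest )
  renaming (_≟_ to _≟ᶠ_)
open import Data.List using (List; []; _∷_; length; lookup; replicate)
open import Data.Nat.ListAction using (sum)
open import Data.List.Membership.Propositional using () renaming (_∈_ to _∈ᴸ_)
open import Data.List.Relation.Unary.Any using (index)
open import Data.List.Relation.Unary.Any.Properties using (lookup-index)
open import Data.Product using (Σ-syntax; uncurry; ∃; ∃-syntax; _×_; _,_; proj₁; proj₂)
open import Data.Sum using (_⊎_; inj₁; inj₂)
import Data.Sum as Sum
import Data.Product as Product
import Data.Vec.Functional as Vec
open import Data.Empty using (⊥; ⊥-elim)
open import Function using (_∘_; flip)
open import Function.Bundles using (_⇔_; Equivalence; mk⇔; mk↔ₛ′)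
open import Function.Properties.Inverse using (↔-sym)
open import Relation.Nullary using (¬_; Dec; yes; no; contradiction)
open import Relation.Nullary.Decidable using (map′; _×-dec_; _→-dec_; ¬?; decidable-stable)
open import Relation.Unary using (_≐_)
open import Relation.Unary.Properties using (≐-refl; ≐-sym; ≐-trans)
open import Relation.Binary.Definitions using (tri<; tri≈; tri>)
open import Relation.Binary.PropositionalEquality

blockIndex : ∀ k m → Fin (sum (replicate k m)) → Fin k × Fin m
blockIndex (suc k) m i with splitAt m i
... | inj₁ s = zero , s
... | inj₂ j = Product.map₁ suc (blockIndex k m j)

blockSlot : ∀ {k m} → Fin k → Fin m → Fin (sum (replicate k m))
blockSlot {suc k} zero        s = s ↑ˡ sum (replicate k _)
blockSlot {suc k} {m} (suc b) s = m ↑ʳ blockSlot b s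

blockIndex-blockSlot : ∀ {k m} (b : Fin k) (s : Fin m) → blockIndex k m (blockSlot b s) ≡ (b , s)
blockIndex-blockSlot {suc k} {m} zero s rewrite splitAt-↑ˡ m s (sum (replicate k m)) = refl
blockIndex-blockSlot {suc k} {m} (suc b) s
  rewrite splitAt-↑ʳ m (sum (replicate k m)) (blockSlot b s) | blockIndex-blockSlot b s = refl

blockSlot-blockIndex : ∀ k m (i : Fin (sum (replicate k m))) → uncurry blockSlot (blockIndex k m i) ≡ i
blockSlot-blockIndex (suc k) m i with splitAt m i in eq
... | inj₁ s = trans (cong (join m _) (sym eq)) (join-splitAt m _ i)
... | inj₂ j = trans (cong (m ↑ʳ_) (blockSlot-blockIndex k m j))
                     (trans (cong (join m _) (sym eq)) (join-splitAt m _ i))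

-- part lands in Fin (length (replicate k m)), which is Fin k only propositionally.
toℕ-part-replicate : ∀ k m (i : Fin (sum (replicate k m))) →
                     toℕ (part (replicate k m) i) ≡ toℕ (proj₁ (blockIndex k m i))
toℕ-part-replicate (suc k) m i with splitAt m i
... | inj₁ _ = refl
... | inj₂ j = cong suc (toℕ-part-replicate k m j)

samePart⇔sameBlock : ∀ k m (i j : Fin (sum (replicate k m))) →
  part (replicate k m) i ≡ part (replicate k m) j ⇔ proj₁ (blockIndex k m i) ≡ proj₁ (blockIndex k m j)
samePart⇔sameBlock k m i j = mk⇔
  (λ eq → toℕ-injective (trans (sym (toℕ-part-replicate k m i)) (trans (cong toℕ eq) (toℕ-part-replicate k m j))))
  (λ eq → toℕ-injective (trans (toℕ-part-replicate k m i) (trans (cong toℕ eq) (sym (toℕ-part-replicate k m j)))))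

module _ {n : ℕ} (G : Graph n) where
  open Graph G renaming (sym to Adj-sym; irrefl to Adj-irrefl)

  private variable
    a a′ b b′ c d p q w x x′ y z : Fin n
    k : ℕ

  walk₀⇒≡ : Walk G x y 0 → x ≡ y
  walk₀⇒≡ (stop _) = refl

  walk₁⇒Adj : Walk G x y 1 → Adj x y
  walk₁⇒Adj (step e (stop _)) = e

  edge-isShortest : x ≢ y → (e : Adj x y) → IsShortest G (step e (stop y))
  edge-isShortest x≢y e {zero}  w = contradiction (walk₀⇒≡ w) x≢y
  edge-isShortest x≢y e {suc _} w = s≤s z≤n

  path₂-isShortest : x ≢ y → ¬ Adj x y → (e₁ : Adj x z) (e₂ : Adj z y) →
                     IsShortest G (step e₁ (step e₂ (stop y)))
  path₂-isShortest x≢y x≁y e₁ e₂ {zero}        w = contradiction (walk₀⇒≡ w) x≢y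
  path₂-isShortest x≢y x≁y e₁ e₂ {suc zero}    w = contradiction (walk₁⇒Adj w) x≁y
  path₂-isShortest x≢y x≁y e₁ e₂ {suc (suc _)} w = s≤s (s≤s z≤n)

  onWalk₀ : ∀ {v} → OnWalk G v (stop x) → v ≡ x
  onWalk₀ here-stop = refl

  onWalk₁ : ∀ {v} {e : Adj x y} → OnWalk G v (step e (stop y)) → v ≡ x ⊎ v ≡ y
  onWalk₁ (here-step _ _) = inj₁ refl
  onWalk₁ (there _ o)     = inj₂ (onWalk₀ o)

  onWalk₂ : ∀ {v} {e₁ : Adj x z} {e₂ : Adj z y} →
            OnWalk G v (step e₁ (step e₂ (stop y))) → v ≡ x ⊎ v ≡ z ⊎ v ≡ y
  onWalk₂ (here-step _ _) = inj₁ refl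
  onWalk₂ (there _ o)     = inj₂ (onWalk₁ o)

  onEdge : ∀ {v} {e : Adj x y} → v ≡ x ⊎ v ≡ y → OnWalk G v (step e (stop y))
  onEdge (inj₁ refl) = here-step _ _
  onEdge (inj₂ refl) = there _ here-stop

  onPath₂ : ∀ {v} {e₁ : Adj x z} {e₂ : Adj z y} →
            v ≡ x ⊎ v ≡ z ⊎ v ≡ y → OnWalk G v (step e₁ (step e₂ (stop y)))
  onPath₂ (inj₁ refl) = here-step _ _
  onPath₂ (inj₂ at)   = there _ (onEdge at)

  SameLine-sym : ∀ {a b c d} → SameLine G a b c d → SameLine G c d a b
  SameLine-sym s v = proj₂ (s v) , proj₁ (s v)

  SameLine-trans : ∀ {a b c d e f} → SameLine G a b c d → SameLine G c d e f → SameLine G a b e f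
  SameLine-trans s t v = proj₁ (t v) ∘ proj₁ (s v) , proj₂ (s v) ∘ proj₂ (t v)

  LineSlot : List (Fin n × Fin n) → Fin n → Fin n → Set
  LineSlot L a b = Σ[ s ∈ Fin (length L) ] uncurry (SameLine G a b) (lookup L s)

  lineSlot : ∀ {L a b} → ∃[ c ] ∃[ d ] ((c , d) ∈ᴸ L × SameLine G a b c d) → LineSlot L a b
  lineSlot {a = a} {b} (c , d , cd∈L , same) =
    index cd∈L , subst (uncurry (SameLine G a b)) (lookup-index cd∈L) same

  sameSlot⇒SameLine : ∀ {L a b a′ b′} (s : LineSlot L a b) (s′ : LineSlot L a′ b′) →
                      proj₁ s ≡ proj₁ s′ → SameLine G a b a′ b′
  sameSlot⇒SameLine (_ , same) (_ , same′) refl = SameLine-trans same (SameLine-sym same′)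

  distinctLines⇒¬FewerLinesThan : ∀ {m} (end₁ end₂ : Fin m → Fin n) →
    (∀ i → end₁ i ≢ end₂ i) →
    (∀ i j → SameLine G (end₁ i) (end₂ i) (end₁ j) (end₂ j) → i ≡ j) →
    ¬ FewerLinesThan G m
  distinctLines⇒¬FewerLinesThan end₁ end₂ ends≢ injective (L , |L|<m , _ , covered) =
    let i , j , i<j , same = pigeonhole |L|<m (proj₁ ∘ slot)
    in <-irrefl (injective i j (sameSlot⇒SameLine {L} (slot i) (slot j) same)) i<j
    where
    slot : ∀ i → LineSlot L (end₁ i) (end₂ i)
    slot i = lineSlot (covered (end₁ i) (end₂ i) (ends≢ i))

  -- Lines of a graph of diameter two

  -- The line ab when the diameter is at most two: beyondˡ is the shortest path c – a – b,
  -- beyondʳ is a – b – c and between is a – c – b.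
  data OnLine (a b : Fin n) : Fin n → Set where
    endˡ    : OnLine a b a
    endʳ    : OnLine a b b
    beyondˡ : ∀ {c} → Adj a b → Adj a c → ¬ Adj b c → OnLine a b c
    beyondʳ : ∀ {c} → Adj a b → Adj b c → ¬ Adj a c → OnLine a b c
    between : ∀ {c} → ¬ Adj a b → Adj a c → Adj b c → OnLine a b c

  ℓ : Fin n × Fin n → Fin n → Set
  ℓ = uncurry OnLine

  Adj⇒≢ : Adj x y → x ≢ y
  Adj⇒≢ x∼y refl = Adj-irrefl x∼y

  Adj-≁⇒≢ : Adj x y → ¬ Adj x z → y ≢ z
  Adj-≁⇒≢ x∼y x≁z refl = x≁z x∼y

  edge⇒OnLine : a ≢ b → Adj x y →
                a ≡ x ⊎ a ≡ y → b ≡ x ⊎ b ≡ y → c ≡ x ⊎ c ≡ y → OnLine a b c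
  edge⇒OnLine a≢b _ (inj₁ refl) (inj₁ refl) _           = contradiction refl a≢b
  edge⇒OnLine a≢b _ (inj₂ refl) (inj₂ refl) _           = contradiction refl a≢b
  edge⇒OnLine _   _ (inj₁ refl) _           (inj₁ refl) = endˡ
  edge⇒OnLine _   _ (inj₂ refl) _           (inj₂ refl) = endˡ
  edge⇒OnLine _   _ _           (inj₁ refl) (inj₁ refl) = endʳ
  edge⇒OnLine _   _ _           (inj₂ refl) (inj₂ refl) = endʳ

  path₂⇒OnLine : ¬ Adj x y → Adj x z → Adj z y → a ≢ b →
                 a ≡ x ⊎ a ≡ z ⊎ a ≡ y → b ≡ x ⊎ b ≡ z ⊎ b ≡ y → c ≡ x ⊎ c ≡ z ⊎ c ≡ y → OnLine a b c
  path₂⇒OnLine _ _ _ a≢b (inj₁ refl)        (inj₁ refl)        _ = contradiction refl a≢b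
  path₂⇒OnLine _ _ _ a≢b (inj₂ (inj₁ refl)) (inj₂ (inj₁ refl)) _ = contradiction refl a≢b
  path₂⇒OnLine _ _ _ a≢b (inj₂ (inj₂ refl)) (inj₂ (inj₂ refl)) _ = contradiction refl a≢b
  path₂⇒OnLine _ _ _ _ (inj₁ refl)        _ (inj₁ refl)        = endˡ
  path₂⇒OnLine _ _ _ _ (inj₂ (inj₁ refl)) _ (inj₂ (inj₁ refl)) = endˡ
  path₂⇒OnLine _ _ _ _ (inj₂ (inj₂ refl)) _ (inj₂ (inj₂ refl)) = endˡ
  path₂⇒OnLine _ _ _ _ _ (inj₁ refl)        (inj₁ refl)        = endʳ
  path₂⇒OnLine _ _ _ _ _ (inj₂ (inj₁ refl)) (inj₂ (inj₁ refl)) = endʳ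
  path₂⇒OnLine _ _ _ _ _ (inj₂ (inj₂ refl)) (inj₂ (inj₂ refl)) = endʳ
  path₂⇒OnLine x≁y x∼z z∼y _ (inj₁ refl)        (inj₂ (inj₁ refl)) (inj₂ (inj₂ refl)) =
    beyondʳ x∼z z∼y x≁y
  path₂⇒OnLine x≁y x∼z z∼y _ (inj₁ refl)        (inj₂ (inj₂ refl)) (inj₂ (inj₁ refl)) =
    between x≁y x∼z (Adj-sym z∼y)
  path₂⇒OnLine x≁y x∼z z∼y _ (inj₂ (inj₁ refl)) (inj₁ refl)        (inj₂ (inj₂ refl)) =
    beyondˡ (Adj-sym x∼z) z∼y x≁y
  path₂⇒OnLine x≁y x∼z z∼y _ (inj₂ (inj₁ refl)) (inj₂ (inj₂ refl)) (inj₁ refl)        =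
    beyondˡ z∼y (Adj-sym x∼z) (x≁y ∘ Adj-sym)
  path₂⇒OnLine x≁y x∼z z∼y _ (inj₂ (inj₂ refl)) (inj₁ refl)        (inj₂ (inj₁ refl)) =
    between (x≁y ∘ Adj-sym) (Adj-sym z∼y) x∼z
  path₂⇒OnLine x≁y x∼z z∼y _ (inj₂ (inj₂ refl)) (inj₂ (inj₁ refl)) (inj₁ refl)        =
    beyondʳ (Adj-sym z∼y) (Adj-sym x∼z) (x≁y ∘ Adj-sym)

  Diameter≤2 : Set
  Diameter≤2 = ∀ x y → ∃[ k ] (k ≤ℕ 2 × Walk G x y k)

  module _ (diam : Diameter≤2) where

    commonNeighbour : x ≢ y → ¬ Adj x y → ∃[ z ] (Adj x z × Adj z y)
    commonNeighbour {x} {y} x≢y x≁y with diam x y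
    ... | 0 , _ , w = contradiction (walk₀⇒≡ w) x≢y
    ... | 1 , _ , w = contradiction (walk₁⇒Adj w) x≁y
    ... | 2 , _ , step e₁ (step e₂ (stop _)) = _ , e₁ , e₂
    ... | suc (suc (suc _)) , s≤s (s≤s ()) , _

    shortest⇒length≤2 : {p : Walk G x y k} → IsShortest G p → k ≤ℕ 2
    shortest⇒length≤2 {x} {y} shortest = let _ , k≤2 , w = diam x y in ≤-trans (shortest w) k≤2

    InLine⇒OnLine : a ≢ b → InLine G a b c → OnLine a b c
    InLine⇒OnLine {a} {b} {c} a≢b (_ , _ , _ , p , shortest , on-a , on-b , on-c) =
      onShortest p shortest on-a on-b on-c
      where
      onShortest : (p : Walk G x y k) → IsShortest G p →
                   OnWalk G a p → OnWalk G b p → OnWalk G c p → OnLine a b c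
      onShortest (stop _) _ on-a on-b _ = contradiction (trans (onWalk₀ on-a) (sym (onWalk₀ on-b))) a≢b
      onShortest (step e (stop _)) _ on-a on-b on-c =
        edge⇒OnLine a≢b e (onWalk₁ on-a) (onWalk₁ on-b) (onWalk₁ on-c)
      onShortest (step e₁ (step e₂ (stop _))) shortest on-a on-b on-c =
        path₂⇒OnLine (λ e → 2≰1 (shortest (step e (stop _)))) e₁ e₂ a≢b
          (onWalk₂ on-a) (onWalk₂ on-b) (onWalk₂ on-c)
        where 2≰1 : ¬ 2 ≤ℕ 1
              2≰1 (s≤s ())
      onShortest p@(step _ (step _ (step _ _))) shortest _ _ _ with shortest⇒length≤2 {p = p} shortest
      ... | s≤s (s≤s ())

    path₂⇒InLine : x ≢ y → ¬ Adj x y → Adj x z → Adj z y →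
                   a ≡ x ⊎ a ≡ z ⊎ a ≡ y → b ≡ x ⊎ b ≡ z ⊎ b ≡ y → c ≡ x ⊎ c ≡ z ⊎ c ≡ y → InLine G a b c
    path₂⇒InLine x≢y x≁y e₁ e₂ at-a at-b at-c =
      _ , _ , 2 , step e₁ (step e₂ (stop _)) , path₂-isShortest x≢y x≁y e₁ e₂ ,
      onPath₂ at-a , onPath₂ at-b , onPath₂ at-c

    end⇒InLine : a ≢ b → c ≡ a ⊎ c ≡ b → InLine G a b c
    end⇒InLine {a} {b} a≢b at-c with adj? a b
    ... | yes e   = a , b , 1 , step e (stop b) , edge-isShortest a≢b e ,
                    onEdge (inj₁ refl) , onEdge (inj₂ refl) , onEdge at-c
    ... | no a≁b = let _ , e₁ , e₂ = commonNeighbour a≢b a≁b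
                   in path₂⇒InLine a≢b a≁b e₁ e₂ (inj₁ refl) (inj₂ (inj₂ refl)) (Sum.map₂ inj₂ at-c)

    OnLine⇒InLine : a ≢ b → OnLine a b c → InLine G a b c
    OnLine⇒InLine a≢b endˡ = end⇒InLine a≢b (inj₁ refl)
    OnLine⇒InLine a≢b endʳ = end⇒InLine a≢b (inj₂ refl)
    OnLine⇒InLine {a} {b} {c} a≢b (beyondˡ a∼b a∼c b≁c) with c ≟ᶠ b
    ... | yes refl = end⇒InLine a≢b (inj₂ refl)
    ... | no c≢b   = path₂⇒InLine c≢b (b≁c ∘ Adj-sym) (Adj-sym a∼c) a∼b
                       (inj₂ (inj₁ refl)) (inj₂ (inj₂ refl)) (inj₁ refl)
    OnLine⇒InLine {a} {b} {c} a≢b (beyondʳ a∼b b∼c a≁c) with c ≟ᶠ a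
    ... | yes refl = end⇒InLine a≢b (inj₁ refl)
    ... | no c≢a   = path₂⇒InLine (c≢a ∘ sym) a≁c a∼b b∼c
                       (inj₁ refl) (inj₂ (inj₁ refl)) (inj₂ (inj₂ refl))
    OnLine⇒InLine a≢b (between a≁b a∼c b∼c) =
      path₂⇒InLine a≢b a≁b a∼c (Adj-sym b∼c) (inj₁ refl) (inj₂ (inj₂ refl)) (inj₂ (inj₁ refl))

    SameLine⇒≐ : a ≢ b → c ≢ d → SameLine G a b c d → OnLine a b ≐ OnLine c d
    SameLine⇒≐ a≢b c≢d same =
      (λ {v} → InLine⇒OnLine c≢d ∘ proj₁ (same v) ∘ OnLine⇒InLine a≢b) ,
      (λ {v} → InLine⇒OnLine a≢b ∘ proj₂ (same v) ∘ OnLine⇒InLine c≢d)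

    pairwiseDistinctLines⇒¬FewerLinesThan : (ends : Fin n → Fin n × Fin n) →
      (∀ i → proj₁ (ends i) ≢ proj₂ (ends i)) →
      (∀ {i j} → i ≢ j → ¬ ℓ (ends i) ≐ ℓ (ends j)) → ¬ FewerLinesThan G n
    pairwiseDistinctLines⇒¬FewerLinesThan ends ends≢ distinct =
      distinctLines⇒¬FewerLinesThan (proj₁ ∘ ends) (proj₂ ∘ ends) ends≢ injective
      where
      injective : ∀ i j → SameLine G (proj₁ (ends i)) (proj₂ (ends i)) (proj₁ (ends j)) (proj₂ (ends j)) → i ≡ j
      injective i j same with i ≟ᶠ j
      ... | yes i≡j = i≡j
      ... | no i≢j  = contradiction (SameLine⇒≐ (ends≢ i) (ends≢ j) same) (distinct i≢j)

  edgeLine-∌-commonNeighbour : Adj a b → c ≢ a → c ≢ b → Adj a c → Adj b c → ¬ OnLine a b c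
  edgeLine-∌-commonNeighbour _ c≢a _ _ _ endˡ = c≢a refl
  edgeLine-∌-commonNeighbour _ _ c≢b _ _ endʳ = c≢b refl
  edgeLine-∌-commonNeighbour _ _ _ _ b∼c (beyondˡ _ _ b≁c) = b≁c b∼c
  edgeLine-∌-commonNeighbour _ _ _ a∼c _ (beyondʳ _ _ a≁c) = a≁c a∼c
  edgeLine-∌-commonNeighbour a∼b _ _ _ _ (between a≁b _ _) = a≁b a∼b

  edgeLine-∌-commonNonNeighbour : Adj a b → c ≢ a → c ≢ b → ¬ Adj a c → ¬ Adj b c → ¬ OnLine a b c
  edgeLine-∌-commonNonNeighbour _ c≢a _ _ _ endˡ = c≢a refl
  edgeLine-∌-commonNonNeighbour _ _ c≢b _ _ endʳ = c≢b refl
  edgeLine-∌-commonNonNeighbour _ _ _ a≁c _ (beyondˡ _ a∼c _) = a≁c a∼c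
  edgeLine-∌-commonNonNeighbour _ _ _ _ b≁c (beyondʳ _ b∼c _) = b≁c b∼c
  edgeLine-∌-commonNonNeighbour a∼b _ _ _ _ (between a≁b _ _) = a≁b a∼b

  nonEdgeLine-∌-nonNeighbour : ¬ Adj a b → c ≢ a → c ≢ b → ¬ Adj a c → ¬ OnLine a b c
  nonEdgeLine-∌-nonNeighbour _ c≢a _ _ endˡ = c≢a refl
  nonEdgeLine-∌-nonNeighbour _ _ c≢b _ endʳ = c≢b refl
  nonEdgeLine-∌-nonNeighbour a≁b _ _ _ (beyondˡ a∼b _ _) = a≁b a∼b
  nonEdgeLine-∌-nonNeighbour a≁b _ _ _ (beyondʳ a∼b _ _) = a≁b a∼b
  nonEdgeLine-∌-nonNeighbour _ _ _ a≁c (between _ a∼c _) = a≁c a∼c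

  -- Twins and their representatives

  Twins : Fin n → Fin n → Set
  Twins a b = Adj a ≐ Adj b

  twins? : ∀ a b → Dec (Twins a b)
  twins? a b = map′ (λ t → (λ {x} → proj₁ (t x)) , (λ {x} → proj₂ (t x))) (λ t x → proj₁ t , proj₂ t)
                    (all? λ x → (adj? a x →-dec adj? b x) ×-dec (adj? b x →-dec adj? a x))

  twin-Adjˡ : Twins a b → Adj x a → Adj x b
  twin-Adjˡ t = Adj-sym ∘ proj₁ t ∘ Adj-sym

  twins⇒≁ : Twins a b → ¬ Adj a b
  twins⇒≁ t a∼b = Adj-irrefl (proj₁ t a∼b)

  OnLine-twin : Twins x y → x ≢ a → x ≢ b → y ≢ a → y ≢ b → OnLine a b x → OnLine a b y
  OnLine-twin _ x≢a _ _ _ endˡ = contradiction refl x≢a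
  OnLine-twin _ _ x≢b _ _ endʳ = contradiction refl x≢b
  OnLine-twin t _ _ _ _ (beyondˡ a∼b a∼x b≁x) = beyondˡ a∼b (twin-Adjˡ t a∼x) (b≁x ∘ twin-Adjˡ (≐-sym t))
  OnLine-twin t _ _ _ _ (beyondʳ a∼b b∼x a≁x) = beyondʳ a∼b (twin-Adjˡ t b∼x) (a≁x ∘ twin-Adjˡ (≐-sym t))
  OnLine-twin t _ _ _ _ (between a≁b a∼x b∼x) = between a≁b (twin-Adjˡ t a∼x) (twin-Adjˡ t b∼x)

  OnLine-twin-edge : Adj a b → Twins x y → OnLine a b x → OnLine a b y
  OnLine-twin-edge {a} {b} {x} {y} a∼b t on-x with y ≟ᶠ a | y ≟ᶠ b | x ≟ᶠ a | x ≟ᶠ b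
  ... | yes refl | _        | _        | _        = endˡ
  ... | no _     | yes refl | _        | _        = endʳ
  ... | no _     | no _     | yes refl | _        = beyondʳ a∼b (twin-Adjˡ t (Adj-sym a∼b)) (twins⇒≁ t)
  ... | no _     | no _     | no _     | yes refl = beyondˡ a∼b (twin-Adjˡ t a∼b) (twins⇒≁ t)
  ... | no y≢a   | no y≢b   | no x≢a   | no x≢b   = OnLine-twin t x≢a x≢b y≢a y≢b on-x

  private
    smallestTwin : ∀ a → ∃ λ i → ¬ ¬ Twins a i × ((j : Fin′ i) → ¬ Twins a (inject j))
    smallestTwin a = ¬∀⟶∃¬-smallest n (¬_ ∘ Twins a) (¬? ∘ twins? a) (λ none → none a ≐-refl)

  rep : Fin n → Fin n
  rep = proj₁ ∘ smallestTwin

  rep-twin : ∀ a → Twins a (rep a)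
  rep-twin a = decidable-stable (twins? a (rep a)) (proj₁ (proj₂ (smallestTwin a)))

  rep-minimal : ∀ a {j} → j <ᶠ rep a → ¬ Twins a j
  rep-minimal a {j} j<rep = subst (¬_ ∘ Twins a) inject-fromℕ< (proj₂ (proj₂ (smallestTwin a)) (fromℕ< j<rep))
    where
    inject-fromℕ< : inject (fromℕ< j<rep) ≡ j
    inject-fromℕ< = toℕ-injective (trans (toℕ-inject (fromℕ< j<rep)) (toℕ-fromℕ< j<rep))

  rep-cong : Twins a b → rep a ≡ rep b
  rep-cong {a} {b} t with <-cmp (rep a) (rep b)
  ... | tri< ra<rb _ _ = contradiction (≐-trans (≐-sym t) (rep-twin a)) (rep-minimal b ra<rb)
  ... | tri≈ _ ra≡rb _ = ra≡rb
  ... | tri> _ _ rb<ra = contradiction (≐-trans t (rep-twin b)) (rep-minimal a rb<ra)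

  rep-idem : ∀ a → rep (rep a) ≡ rep a
  rep-idem a = rep-cong (≐-sym (rep-twin a))

  -- Universal pairs

  record UniversalPair (x x′ : Fin n) : Set where
    field
      distinct    : x′ ≢ x
      nonadjacent : ¬ Adj x x′
      adjacentˡ   : ∀ {z} → z ≢ x → z ≢ x′ → Adj x z
      adjacentʳ   : ∀ {z} → z ≢ x → z ≢ x′ → Adj x′ z

  UniversalPair-swap : UniversalPair x y → UniversalPair y x
  UniversalPair-swap u = record
    { distinct = distinct ∘ sym ; nonadjacent = nonadjacent ∘ Adj-sym
    ; adjacentˡ = λ z≢y z≢x → adjacentʳ z≢x z≢y ; adjacentʳ = λ z≢y z≢x → adjacentˡ z≢x z≢y }
    where open UniversalPair u

  UniversalPair-≁ : UniversalPair x y → ¬ Adj x z → z ≡ x ⊎ z ≡ y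
  UniversalPair-≁ {x} {y} {z} u x≁z with z ≟ᶠ x | z ≟ᶠ y
  ... | yes z≡x | _       = inj₁ z≡x
  ... | no _    | yes z≡y = inj₂ z≡y
  ... | no z≢x  | no z≢y  = contradiction (UniversalPair.adjacentˡ u z≢x z≢y) x≁z

  UniversalPair-twin : UniversalPair x y → Twins x z → z ≡ x ⊎ z ≡ y
  UniversalPair-twin {x} {y} {z} u t with z ≟ᶠ x
  ... | yes z≡x = inj₁ z≡x
  ... | no _    = UniversalPair-≁ u (twins⇒≁ t)

  InUniversalPair : Fin n → Set
  InUniversalPair x = ∃ (UniversalPair x)

  universalPair? : ∀ x x′ → Dec (UniversalPair x x′)
  universalPair? x x′ =
    map′ (λ (d , x≁x′ , l , r) → record { distinct = d ; nonadjacent = x≁x′ ; adjacentˡ = l _ ; adjacentʳ = r _ })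
         (λ u → let open UniversalPair u in distinct , nonadjacent , (λ _ → adjacentˡ) , (λ _ → adjacentʳ))
         (¬? (x′ ≟ᶠ x) ×-dec ¬? (adj? x x′) ×-dec adjacentToOthers? x ×-dec adjacentToOthers? x′)
    where
    adjacentToOthers? : ∀ u → Dec (∀ z → z ≢ x → z ≢ x′ → Adj u z)
    adjacentToOthers? u = all? λ z → ¬? (z ≟ᶠ x) →-dec ¬? (z ≟ᶠ x′) →-dec adj? u z

  inUniversalPair? : ∀ x → Dec (InUniversalPair x)
  inUniversalPair? x = any? (universalPair? x)

  UniversalPair⇒Adj-unpaired : UniversalPair x x′ → ¬ InUniversalPair z → Adj x z
  UniversalPair⇒Adj-unpaired {x} {x′} {z} u z-unpaired with adj? x z
  ... | yes x∼z = x∼z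
  ... | no x≁z with UniversalPair-≁ u x≁z
  ...   | inj₁ refl = contradiction (x′ , u) z-unpaired
  ...   | inj₂ refl = contradiction (x , UniversalPair-swap u) z-unpaired

  UniversalPairs-Adj : UniversalPair a a′ → UniversalPair b b′ → Adj a b → Adj a b′
  UniversalPairs-Adj {a} {a′} {b} {b′} ua ub a∼b with adj? a b′
  ... | yes a∼b′ = a∼b′
  ... | no a≁b′ with UniversalPair-≁ ua a≁b′
  ...   | inj₁ refl = contradiction (Adj-sym a∼b) (UniversalPair.nonadjacent ub)
  ...   | inj₂ refl with UniversalPair-≁ (UniversalPair-swap ua) (UniversalPair.nonadjacent ub ∘ Adj-sym)
  ...     | inj₁ refl = contradiction refl (UniversalPair.distinct ub)
  ...     | inj₂ refl = contradiction a∼b Adj-irrefl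

  unpaired-¬twin : ¬ InUniversalPair z → UniversalPair a (rep a) → ¬ Twins a z
  unpaired-¬twin {z} {a} z-unpaired ua t with UniversalPair-twin ua t
  ... | inj₁ refl = z-unpaired (rep z , ua)
  ... | inj₂ refl = z-unpaired (a , UniversalPair-swap ua)

  NoThirdTwin : Fin n → Set
  NoThirdTwin a = ∀ {c} → Twins a c → c ≢ a → c ≡ rep a

  UniversalPair⇒NoThirdTwin : UniversalPair a (rep a) → NoThirdTwin a
  UniversalPair⇒NoThirdTwin u t c≢a with UniversalPair-twin u t
  ... | inj₁ c≡a   = contradiction c≡a c≢a
  ... | inj₂ c≡rep = c≡rep

  nonReps-twins⇒≡ : NoThirdTwin a → Twins a b → rep a ≢ a → rep b ≢ b → a ≡ b
  nonReps-twins⇒≡ {a} {b} noThird t _ rb≢b with b ≟ᶠ a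
  ... | yes b≡a = sym b≡a
  ... | no b≢a  = contradiction (trans (cong rep b≡ra) (trans (rep-idem a) (sym b≡ra))) rb≢b
    where
    b≡ra : b ≡ rep a
    b≡ra = noThird t b≢a

  ¬thirdTwin⇒NoThirdTwin : ¬ (∃ λ c → Twins a c × c ≢ a × c ≢ rep a) → NoThirdTwin a
  ¬thirdTwin⇒NoThirdTwin {a} noThird {c} t c≢a with c ≟ᶠ rep a
  ... | yes c≡rep = c≡rep
  ... | no c≢rep  = contradiction (c , t , c≢a , c≢rep) noThird

  ¬witness⇒UniversalPair : rep a ≢ a → NoThirdTwin a → ¬ (∃ λ z → ¬ Adj a z × ¬ Twins a z) →
                           UniversalPair a (rep a)
  ¬witness⇒UniversalPair {a} notRep noThird noWitness = record
    { distinct = notRep ; nonadjacent = twins⇒≁ (rep-twin a)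
    ; adjacentˡ = adjacent ; adjacentʳ = λ z≢a z≢rep → proj₁ (rep-twin a) (adjacent z≢a z≢rep) }
    where
    adjacent : z ≢ a → z ≢ rep a → Adj a z
    adjacent {z} z≢a z≢rep with adj? a z | twins? a z
    ... | yes a∼z | _      = a∼z
    ... | no _    | yes t  = contradiction (noThird t z≢a) z≢rep
    ... | no a≁z  | no ¬t  = contradiction (z , a≁z , ¬t) noWitness

  twin-≢ : Twins a c → ¬ Twins a b → c ≢ b
  twin-≢ t ¬t refl = ¬t t

  NoThirdTwin-¬three : NoThirdTwin a → Twins a x → Twins a y → Twins a z → x ≢ y → z ≢ x → z ≢ y → ⊥
  NoThirdTwin-¬three {a} {x} {y} {z} noThird a≈x a≈y a≈z x≢y z≢x z≢y with x ≟ᶠ a | y ≟ᶠ a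
  ... | yes refl | _        = z≢y (trans (noThird a≈z z≢x) (sym (noThird a≈y (x≢y ∘ sym))))
  ... | no x≢a   | yes refl = z≢x (trans (noThird a≈z z≢y) (sym (noThird a≈x x≢a)))
  ... | no x≢a   | no y≢a   = x≢y (trans (noThird a≈x x≢a) (sym (noThird a≈y y≢a)))

  ≉-by : OnLine a b x → ¬ OnLine c d x → ¬ OnLine a b ≐ OnLine c d
  ≉-by x∈ab x∉cd (⊆ , _) = x∉cd (⊆ x∈ab)

  ≉-by-transfer : OnLine a b x → ¬ OnLine a b y → (OnLine c d x → OnLine c d y) → ¬ OnLine a b ≐ OnLine c d
  ≉-by-transfer x∈ab y∉ab transfer (⊆ , ⊇) = y∉ab (⊇ (transfer (⊆ x∈ab)))

  nonRep-≢-rep : rep a ≢ a → a ≢ rep b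
  nonRep-≢-rep {a} {b} notRep a≡rep = notRep (trans (cong rep a≡rep) (trans (rep-idem b) (sym a≡rep)))

  ≡rep⇒Twins : x ≡ rep a → Twins a x
  ≡rep⇒Twins {a = a} x≡rep = subst (Twins a) (sym x≡rep) (rep-twin a)

  UniversalPair⇒Adj-nonTwin : UniversalPair a (rep a) → ¬ Twins a z → Adj a z
  UniversalPair⇒Adj-nonTwin {a} u ¬t =
    UniversalPair.adjacentˡ u (¬t ∘ flip (subst (Twins a)) ≐-refl ∘ sym)
                              (¬t ∘ flip (subst (Twins a)) (rep-twin a) ∘ sym)

  spokeLine-twin : b ≢ c → Adj c x → Twins x y → OnLine c b x → OnLine c b y
  spokeLine-twin {b} {c} {y = y} b≢c c∼x t x∈cb with adj? c b
  ... | yes c∼b = OnLine-twin-edge c∼b t x∈cb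
  ... | no c≁b  = OnLine-twin t (Adj⇒≢ c∼x ∘ sym) (Adj-≁⇒≢ c∼x c≁b) (Adj⇒≢ c∼y ∘ sym) (Adj-≁⇒≢ c∼y c≁b) x∈cb
    where
    c∼y : Adj c y
    c∼y = twin-Adjˡ t c∼x

  twinLine-∋-neighbour : Adj c a → OnLine a (rep a) c
  twinLine-∋-neighbour {a = a} c∼a =
    between (twins⇒≁ (rep-twin a)) (Adj-sym c∼a) (proj₁ (rep-twin a) (Adj-sym c∼a))

  twinLine-∌-thirdTwin : Twins a c → c ≢ a → c ≢ rep a → ¬ OnLine a (rep a) c
  twinLine-∌-thirdTwin {a} t c≢a c≢rep = nonEdgeLine-∌-nonNeighbour (twins⇒≁ (rep-twin a)) c≢a c≢rep (twins⇒≁ t)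

  nonTwinLine-∌-rep : rep a ≢ a → ¬ Adj a z → ¬ Twins a z → ¬ OnLine a z (rep a)
  nonTwinLine-∌-rep {a} notRep a≁z ¬t =
    nonEdgeLine-∌-nonNeighbour a≁z notRep (¬t ∘ flip (subst (Twins a)) (rep-twin a)) (twins⇒≁ (rep-twin a))

  ≉-sym : ¬ OnLine a b ≐ OnLine c d → ¬ OnLine c d ≐ OnLine a b
  ≉-sym ≉ = ≉ ∘ ≐-sym

  twinLine-≉-transfer : Twins a c → c ≢ a → c ≢ rep a → (OnLine x y a → OnLine x y c) →
                       ¬ OnLine a (rep a) ≐ OnLine x y
  twinLine-≉-transfer t c≢a c≢rep = ≉-by-transfer endˡ (twinLine-∌-thirdTwin t c≢a c≢rep)

  nonTwinLine-≉-transfer : rep a ≢ a → ¬ Adj a z → ¬ Twins a z → (OnLine x y a → OnLine x y (rep a)) →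
                         ¬ OnLine a z ≐ OnLine x y
  nonTwinLine-≉-transfer notRep a≁z ¬a≈z = ≉-by-transfer endˡ (nonTwinLine-∌-rep notRep a≁z ¬a≈z)

  edgeLine-≉-via-commonNeighbour : Adj a b → Adj a z → Adj b z → OnLine c d z → ¬ OnLine a b ≐ OnLine c d
  edgeLine-≉-via-commonNeighbour a∼b a∼z b∼z z∈cd =
    ≉-sym (≉-by z∈cd (edgeLine-∌-commonNeighbour a∼b (Adj⇒≢ a∼z ∘ sym) (Adj⇒≢ b∼z ∘ sym) a∼z b∼z))

  AllOnWalk-head : ∀ {P} {w : Walk G x y k} → AllOnWalk G P w → P x
  AllOnWalk-head (all-stop p)   = p
  AllOnWalk-head (all-step p _) = p

  module _ (locallyConnected : LocallyConnected G) where

    edge-inTriangle : Adj c x → Adj c y → x ≢ y → ∃[ z ] (Adj c z × Adj x z)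
    edge-inTriangle {c} {x} {y} c∼x c∼y x≢y with locallyConnected c x y c∼x c∼y
    ... | _ , stop _ , _ = contradiction refl x≢y
    ... | _ , step x∼z _ , all-step _ inside = _ , AllOnWalk-head inside , x∼z

    spokeLine-≉-beyond : Adj c a → Adj a b → ¬ Adj c b → b ≢ c → ¬ OnLine c a ≐ OnLine c b
    spokeLine-≉-beyond {c} {a} {b} c∼a a∼b c≁b b≢c (⊆ , ⊇) with edge-inTriangle a∼b (Adj-sym c∼a) b≢c
    ... | z , a∼z , b∼z with adj? c z
    ...   | yes c∼z = edgeLine-∌-commonNeighbour c∼a (Adj-≁⇒≢ b∼z (c≁b ∘ Adj-sym)) (Adj⇒≢ (Adj-sym a∼z)) c∼z a∼z
                        (⊇ (between c≁b c∼z b∼z))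
    ...   | no c≁z  = nonEdgeLine-∌-nonNeighbour c≁b (Adj-≁⇒≢ b∼z (c≁b ∘ Adj-sym)) (Adj⇒≢ (Adj-sym b∼z)) c≁z
                        (⊆ (beyondʳ c∼a a∼z c≁z))

    sameSpokeLine⇒Adj-⊆ : OnLine c a ≐ OnLine c b → Adj c a → Adj c b → ¬ Adj a b → Adj a x → Adj b x
    sameSpokeLine⇒Adj-⊆ {c} {a} {b} {x} (⊆ , ⊇) c∼a c∼b a≁b a∼x
      with x ≟ᶠ c | x ≟ᶠ b | adj? b x | adj? c x
    ... | yes refl | _        | _       | _       = Adj-sym c∼b
    ... | no _     | yes refl | _       | _       = contradiction a∼x a≁b
    ... | no _     | no _     | yes b∼x | _       = b∼x
    ... | no x≢c   | no _     | no b≁x  | yes c∼x =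
      contradiction (⊇ (beyondˡ c∼b c∼x b≁x)) (edgeLine-∌-commonNeighbour c∼a x≢c (Adj⇒≢ (Adj-sym a∼x)) c∼x a∼x)
    ... | no x≢c   | no x≢b   | no b≁x  | no c≁x  =
      contradiction (⊆ (beyondʳ c∼a a∼x c≁x)) (edgeLine-∌-commonNonNeighbour c∼b x≢c x≢b c≁x b≁x)

    sameSpokeLine⇒twins : a ≢ b → a ≢ c → b ≢ c → OnLine c a ≐ OnLine c b → Adj c a × Adj c b × Twins a b
    sameSpokeLine⇒twins a≢b a≢c b≢c same@(_ , ⊇) with ⊇ endʳ
    ... | endˡ = contradiction refl b≢c
    ... | endʳ = contradiction refl (a≢b ∘ sym)
    ... | beyondˡ c∼a c∼b a≁b =
      c∼a , c∼b , sameSpokeLine⇒Adj-⊆ same c∼a c∼b a≁b , sameSpokeLine⇒Adj-⊆ (≐-sym same) c∼b c∼a (a≁b ∘ Adj-sym)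
    ... | beyondʳ c∼a a∼b c≁b = contradiction same (spokeLine-≉-beyond c∼a a∼b c≁b b≢c)
    ... | between c≁a c∼b a∼b = contradiction (≐-sym same) (spokeLine-≉-beyond c∼b (Adj-sym a∼b) c≁a a≢c)

    -- Only the representative of each twin class in N(v) keeps its spoke line vb; any other
    -- neighbour a gets a line through a that misses a third twin (crowded) or rep a
    -- (witnessed), unless {a, rep a} is a universal pair.
    module LineAssignment (v y s s′ p p′ : Fin n) where

      data Role : Fin n → Set where
        centre     : Role v
        spoke      : a ≢ v → ¬ Adj v a ⊎ rep a ≡ a → Role a
        crowded    : Adj v a → rep a ≢ a → Twins a c → c ≢ a → c ≢ rep a → Role a
        witnessed  : Adj v a → rep a ≢ a → NoThirdTwin a → ¬ Adj a z → ¬ Twins a z → rep z ≡ z → Role a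
        universal  : Adj v a → UniversalPair a (rep a) → ¬ Twins a y → Role a
        yTwin : Adj v a → UniversalPair a (rep a) → Twins a y → Role a

      lineOf : Role a → Fin n × Fin n
      lineOf centre                                = p , p′
      lineOf {a} (spoke _ _)                       = v , a
      lineOf {a} (crowded _ _ _ _ _)               = a , rep a
      lineOf {a} (witnessed {z = z} _ _ _ _ _ _)   = a , z
      lineOf {a} (universal _ _ _)                 = a , y
      lineOf (yTwin _ _ _)                         = s , s′

      pairRole : Adj v a → rep a ≢ a → NoThirdTwin a → Role a
      pairRole {a} v∼a notRep noThird with any? (λ z → ¬? (adj? a z) ×-dec ¬? (twins? a z))
      ... | yes (z , a≁z , ¬t) =
        witnessed v∼a notRep noThird (a≁z ∘ twin-Adjˡ (≐-sym (rep-twin z)))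
                  (¬t ∘ flip ≐-trans (≐-sym (rep-twin z))) (rep-idem z)
      ... | no noWitness with twins? a y
      ...   | yes t = yTwin v∼a (¬witness⇒UniversalPair notRep noThird noWitness) t
      ...   | no ¬t = universal v∼a (¬witness⇒UniversalPair notRep noThird noWitness) ¬t

      nonRepRole : Adj v a → rep a ≢ a → Role a
      nonRepRole {a} v∼a notRep with any? (λ c → twins? a c ×-dec ¬? (c ≟ᶠ a) ×-dec ¬? (c ≟ᶠ rep a))
      ... | yes (_ , t , c≢a , c≢rep) = crowded v∼a notRep t c≢a c≢rep
      ... | no noThird = pairRole v∼a notRep (¬thirdTwin⇒NoThirdTwin noThird)

      role : ∀ a → Role a
      role a with a ≟ᶠ v
      ... | yes refl = centre
      ... | no a≢v with adj? v a | rep a ≟ᶠ a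
      ...   | no v≁a  | _         = spoke a≢v (inj₁ v≁a)
      ...   | yes _   | yes isRep = spoke a≢v (inj₂ isRep)
      ...   | yes v∼a | no notRep = nonRepRole v∼a notRep

      module Distinct
        (v∼y : Adj v y) (s∼s′ : Adj s s′) (v∼s : Adj v s) (v∼s′ : Adj v s′) (p≢p′ : p ≢ p′)
        (centre-≉ : ∀ {a} (r : Role a) → a ≢ v → ¬ ℓ (p , p′) ≐ ℓ (lineOf r))
        (yTwin-≉-universal : ∀ {a b} → Adj v a → UniversalPair a (rep a) → ¬ Twins a y →
                             Adj v b → UniversalPair b (rep b) → Twins b y → ¬ ℓ (s , s′) ≐ ℓ (a , y))
        where

        yTwinLine-∌-centre : ¬ OnLine s s′ v
        yTwinLine-∌-centre = edgeLine-∌-commonNeighbour s∼s′ (Adj⇒≢ v∼s) (Adj⇒≢ v∼s′) (Adj-sym v∼s) (Adj-sym v∼s′)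

        spoke≉spoke : a ≢ b → a ≢ v → b ≢ v → ¬ Adj v a ⊎ rep a ≡ a → ¬ Adj v b ⊎ rep b ≡ b →
                      ¬ OnLine v a ≐ OnLine v b
        spoke≉spoke a≢b a≢v b≢v a-spoke b-spoke same with sameSpokeLine⇒twins a≢b a≢v b≢v same
        spoke≉spoke _   _   _   (inj₁ v≁a) _          _ | v∼a , _ , _ = v≁a v∼a
        spoke≉spoke _   _   _   _          (inj₁ v≁b) _ | _ , v∼b , _ = v≁b v∼b
        spoke≉spoke a≢b _   _   (inj₂ ra≡a) (inj₂ rb≡b) _ | _ , _ , t =
          a≢b (trans (sym ra≡a) (trans (rep-cong t) rb≡b))

        crowded≉crowded : a ≢ b → rep a ≢ a → Twins a c → c ≢ a → c ≢ rep a → rep b ≢ b →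
                          ¬ OnLine a (rep a) ≐ OnLine b (rep b)
        crowded≉crowded {a} {b} {c} a≢b a-notRep t c≢a c≢rep b-notRep with twins? b a
        ... | yes b≈a = ≉-by endˡ (nonEdgeLine-∌-nonNeighbour (twins⇒≁ (rep-twin b)) a≢b (nonRep-≢-rep a-notRep)
                                                              (twins⇒≁ b≈a))
        ... | no ¬b≈a = ≉-by-transfer endˡ (twinLine-∌-thirdTwin t c≢a c≢rep)
                          (OnLine-twin t a≢b (¬b≈a ∘ ≡rep⇒Twins) c≢b c≢rep-b)
          where
          c≢b : c ≢ b
          c≢b c≡b = ¬b≈a (subst (flip Twins a) c≡b (≐-sym t))
          c≢rep-b : c ≢ rep b
          c≢rep-b c≡rep = ¬b≈a (≐-trans (≡rep⇒Twins c≡rep) (≐-sym t))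

        witnessed≉twinLine : a ≢ b → rep a ≢ a → rep b ≢ b → NoThirdTwin b → ¬ Adj b z → ¬ Twins b z →
                             ¬ OnLine b z ≐ OnLine a (rep a)
        witnessed≉twinLine {a} {b} a≢b a-notRep b-notRep b-noThird b≁z ¬b≈z =
          ≉-by-transfer endˡ (nonTwinLine-∌-rep b-notRep b≁z ¬b≈z)
            (OnLine-twin (rep-twin b) (a≢b ∘ sym) (nonRep-≢-rep b-notRep) (nonRep-≢-rep a-notRep ∘ sym)
                         (λ reps≡ → ¬b≈a (≐-trans (rep-twin b) (≐-sym (≡rep⇒Twins reps≡)))))
          where
          ¬b≈a : ¬ Twins b a
          ¬b≈a b≈a = nonRep-≢-rep a-notRep (b-noThird b≈a a≢b)

        witnessed≉witnessed : a ≢ b → rep a ≢ a → NoThirdTwin a → ¬ Adj a z → ¬ Twins a z →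
                              rep b ≢ b → rep c ≡ c → ¬ OnLine a z ≐ OnLine b c
        witnessed≉witnessed {a} {b} {c = c} a≢b a-notRep a-noThird a≁z ¬a≈z b-notRep c-isRep =
          ≉-by-transfer endˡ (nonTwinLine-∌-rep a-notRep a≁z ¬a≈z) transfer
          where
          ¬a≈b : ¬ Twins a b
          ¬a≈b a≈b = a≢b (nonReps-twins⇒≡ a-noThird a≈b a-notRep b-notRep)
          transfer : OnLine b c a → OnLine b c (rep a)
          transfer a∈bc with rep a ≟ᶠ c
          ... | yes refl  = endʳ
          ... | no rep≢c  = OnLine-twin (rep-twin a) a≢b (subst (a ≢_) c-isRep (nonRep-≢-rep a-notRep))
                              (¬a≈b ∘ ≡rep⇒Twins ∘ sym) rep≢c a∈bc

        universal≉universal : a ≢ b → UniversalPair a (rep a) → ¬ Twins a y →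
                              UniversalPair b (rep b) → ¬ Twins b y → ¬ OnLine a y ≐ OnLine b y
        universal≉universal {a} {b} a≢b ua ¬a≈y ub ¬b≈y =
          ≉-by endˡ (edgeLine-∌-commonNeighbour b∼y a≢b (Adj⇒≢ a∼y) (UniversalPair⇒Adj-nonTwin ub ¬b≈a)
                                                (Adj-sym a∼y))
          where
          a∼y : Adj a y
          a∼y = UniversalPair⇒Adj-nonTwin ua ¬a≈y
          b∼y : Adj b y
          b∼y = UniversalPair⇒Adj-nonTwin ub ¬b≈y
          ¬b≈a : ¬ Twins b a
          ¬b≈a b≈a = nonRep-≢-rep (UniversalPair.distinct ua) (UniversalPair⇒NoThirdTwin ub b≈a a≢b)

        yTwin-unique : UniversalPair a (rep a) → Twins a y → UniversalPair b (rep b) → Twins b y → a ≡ b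
        yTwin-unique ua a≈y ub b≈y =
          nonReps-twins⇒≡ (UniversalPair⇒NoThirdTwin ua) (≐-trans a≈y (≐-sym b≈y))
                          (UniversalPair.distinct ua) (UniversalPair.distinct ub)

        universal-∌-centre : Adj v a → UniversalPair a (rep a) → ¬ Twins a y → ¬ OnLine a y v
        universal-∌-centre v∼a ua ¬a≈y =
          edgeLine-∌-commonNeighbour (UniversalPair⇒Adj-nonTwin ua ¬a≈y) (Adj⇒≢ v∼a) (Adj⇒≢ v∼y)
                                     (Adj-sym v∼a) (Adj-sym v∼y)

        lineOf-≉ : a ≢ b → (ra : Role a) (rb : Role b) → ¬ ℓ (lineOf ra) ≐ ℓ (lineOf rb)
        lineOf-≉ a≢b centre centre = contradiction refl a≢b
        lineOf-≉ a≢b centre rb     = centre-≉ rb (a≢b ∘ sym)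
        lineOf-≉ a≢b ra     centre = ≉-sym (centre-≉ ra a≢b)
        lineOf-≉ a≢b (spoke a≢v sa) (spoke b≢v sb) = spoke≉spoke a≢b a≢v b≢v sa sb
        lineOf-≉ a≢b (spoke a≢v _) (crowded v∼b _ t c≢b c≢rep) =
          ≉-sym (twinLine-≉-transfer t c≢b c≢rep (spokeLine-twin a≢v v∼b t))
        lineOf-≉ a≢b (spoke a≢v _) (witnessed v∼b notRep _ b≁z ¬b≈z _) =
          ≉-sym (nonTwinLine-≉-transfer notRep b≁z ¬b≈z (spokeLine-twin a≢v v∼b (rep-twin _)))
        lineOf-≉ a≢b (spoke _ _) (universal v∼b ub ¬b≈y) = ≉-by endˡ (universal-∌-centre v∼b ub ¬b≈y)
        lineOf-≉ a≢b (spoke _ _) (yTwin _ _ _) = ≉-by endˡ yTwinLine-∌-centre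
        lineOf-≉ a≢b (crowded v∼a _ t c≢a c≢rep) (spoke b≢v _) =
          twinLine-≉-transfer t c≢a c≢rep (spokeLine-twin b≢v v∼a t)
        lineOf-≉ a≢b (crowded _ notRep t c≢a c≢rep) (crowded _ b-notRep _ _ _) =
          crowded≉crowded a≢b notRep t c≢a c≢rep b-notRep
        lineOf-≉ a≢b (crowded _ notRep _ _ _) (witnessed _ b-notRep b-noThird b≁z ¬b≈z _) =
          ≉-sym (witnessed≉twinLine a≢b notRep b-notRep b-noThird b≁z ¬b≈z)
        lineOf-≉ a≢b (crowded v∼a _ _ _ _) (universal v∼b ub ¬b≈y) =
          ≉-by (twinLine-∋-neighbour v∼a) (universal-∌-centre v∼b ub ¬b≈y)
        lineOf-≉ a≢b (crowded v∼a _ _ _ _) (yTwin _ _ _) = ≉-by (twinLine-∋-neighbour v∼a) yTwinLine-∌-centre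
        lineOf-≉ a≢b (witnessed v∼a notRep _ a≁z ¬a≈z _) (spoke b≢v _) =
          nonTwinLine-≉-transfer notRep a≁z ¬a≈z (spokeLine-twin b≢v v∼a (rep-twin _))
        lineOf-≉ a≢b (witnessed _ notRep a-noThird a≁z ¬a≈z _) (crowded _ b-notRep _ _ _) =
          witnessed≉twinLine (a≢b ∘ sym) b-notRep notRep a-noThird a≁z ¬a≈z
        lineOf-≉ a≢b (witnessed _ notRep a-noThird a≁z ¬a≈z _) (witnessed _ b-notRep _ _ _ c-isRep) =
          witnessed≉witnessed a≢b notRep a-noThird a≁z ¬a≈z b-notRep c-isRep
        lineOf-≉ a≢b (witnessed _ notRep _ a≁z ¬a≈z _) (universal _ ub ¬b≈y) =
          nonTwinLine-≉-transfer notRep a≁z ¬a≈z (OnLine-twin-edge (UniversalPair⇒Adj-nonTwin ub ¬b≈y) (rep-twin _))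
        lineOf-≉ a≢b (witnessed _ notRep _ a≁z ¬a≈z _) (yTwin _ _ _) =
          nonTwinLine-≉-transfer notRep a≁z ¬a≈z (OnLine-twin-edge s∼s′ (rep-twin _))
        lineOf-≉ a≢b (universal v∼a ua ¬a≈y) (spoke _ _) = ≉-sym (≉-by endˡ (universal-∌-centre v∼a ua ¬a≈y))
        lineOf-≉ a≢b (universal v∼a ua ¬a≈y) (crowded v∼b _ _ _ _) =
          ≉-sym (≉-by (twinLine-∋-neighbour v∼b) (universal-∌-centre v∼a ua ¬a≈y))
        lineOf-≉ a≢b (universal _ ua ¬a≈y) (witnessed _ notRep _ b≁z ¬b≈z _) =
          ≉-sym (nonTwinLine-≉-transfer notRep b≁z ¬b≈z
                   (OnLine-twin-edge (UniversalPair⇒Adj-nonTwin ua ¬a≈y) (rep-twin _)))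
        lineOf-≉ a≢b (universal _ ua ¬a≈y) (universal _ ub ¬b≈y) = universal≉universal a≢b ua ¬a≈y ub ¬b≈y
        lineOf-≉ a≢b (universal v∼a ua ¬a≈y) (yTwin v∼b ub b≈y) =
          ≉-sym (yTwin-≉-universal v∼a ua ¬a≈y v∼b ub b≈y)
        lineOf-≉ a≢b (yTwin _ _ _) (spoke _ _) = ≉-sym (≉-by endˡ yTwinLine-∌-centre)
        lineOf-≉ a≢b (yTwin _ _ _) (crowded v∼b _ _ _ _) = ≉-sym (≉-by (twinLine-∋-neighbour v∼b) yTwinLine-∌-centre)
        lineOf-≉ a≢b (yTwin _ _ _) (witnessed _ notRep _ b≁z ¬b≈z _) =
          ≉-sym (nonTwinLine-≉-transfer notRep b≁z ¬b≈z (OnLine-twin-edge s∼s′ (rep-twin _)))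
        lineOf-≉ a≢b (yTwin v∼a ua a≈y) (universal v∼b ub ¬b≈y) = yTwin-≉-universal v∼b ub ¬b≈y v∼a ua a≈y
        lineOf-≉ a≢b (yTwin _ ua a≈y) (yTwin _ ub b≈y) = contradiction (yTwin-unique ua a≈y ub b≈y) a≢b

        lineOf-ends-≢ : (r : Role a) → proj₁ (lineOf r) ≢ proj₂ (lineOf r)
        lineOf-ends-≢ centre                            = p≢p′
        lineOf-ends-≢ (spoke a≢v _)                     = a≢v ∘ sym
        lineOf-ends-≢ (crowded _ notRep _ _ _)          = notRep ∘ sym
        lineOf-ends-≢ (witnessed _ _ _ _ ¬a≈z _) a≡z    = ¬a≈z (subst (Twins _) a≡z ≐-refl)
        lineOf-ends-≢ (universal _ _ ¬a≈y) a≡y          = ¬a≈y (subst (Twins _) a≡y ≐-refl)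
        lineOf-ends-≢ (yTwin _ _ _)                     = Adj⇒≢ s∼s′

        ¬FewerLinesThan : Diameter≤2 → ¬ FewerLinesThan G n
        ¬FewerLinesThan diam = pairwiseDistinctLines⇒¬FewerLinesThan diam (lineOf ∘ role) (lineOf-ends-≢ ∘ role)
                                 λ {i} {j} i≢j → lineOf-≉ i≢j (role i) (role j)

      centreEdge-≉ : Adj p p′ → Adj v p → Adj v p′ →
        (∀ {a} → Adj v a → UniversalPair a (rep a) → ¬ Twins a y → ¬ ℓ (p , p′) ≐ ℓ (a , y)) →
        (∀ {a} → Adj v a → UniversalPair a (rep a) → Twins a y → ¬ ℓ (p , p′) ≐ ℓ (s , s′)) →
        ∀ {a} (r : Role a) → a ≢ v → ¬ ℓ (p , p′) ≐ ℓ (lineOf r)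
      centreEdge-≉ p∼p′ v∼p v∼p′ ≉-universal ≉-yTwin = λ where
          centre                            a≢v → contradiction refl a≢v
          (spoke _ _)                       _   → ≉-sym (≉-by endˡ centre-∉)
          (crowded v∼a _ _ _ _)             _   → ≉-sym (≉-by (twinLine-∋-neighbour v∼a) centre-∉)
          (witnessed _ notRep _ a≁z ¬a≈z _) _   →
            ≉-sym (nonTwinLine-≉-transfer notRep a≁z ¬a≈z (OnLine-twin-edge p∼p′ (rep-twin _)))
          (universal v∼a ua ¬a≈y)           _   → ≉-universal v∼a ua ¬a≈y
          (yTwin v∼a ua a≈y)                _   → ≉-yTwin v∼a ua a≈y
        where
        centre-∉ : ¬ OnLine p p′ v
        centre-∉ = edgeLine-∌-commonNeighbour p∼p′ (Adj⇒≢ v∼p) (Adj⇒≢ v∼p′) (Adj-sym v∼p) (Adj-sym v∼p′)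

  -- Recognising complete multipartite graphs

  enumeration⇒≅K : ∀ ms (vertex : Fin (sum ms) → Fin n) →
    (∀ {i j} → vertex i ≡ vertex j → i ≡ j) → (∀ z → ∃[ i ] vertex i ≡ z) →
    (∀ i j → Adj (vertex i) (vertex j) ⇔ part ms i ≢ part ms j) → G ≅ K ms
  enumeration⇒≅K ms vertex injective surjective adjacency =
    ↔-sym (mk↔ₛ′ vertex position (proj₂ ∘ surjective) (injective ∘ proj₂ ∘ surjective ∘ vertex)) ,
    λ x y → subst₂ (λ u w → Adj u w ⇔ part ms (position x) ≢ part ms (position y))
                   (proj₂ (surjective x)) (proj₂ (surjective y)) (adjacency (position x) (position y))
    where
    position : Fin n → Fin (sum ms)
    position = proj₁ ∘ surjective

  record PairClique (k : ℕ) : Set where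
    field
      leader partner : Fin k → Fin n
      universalPair  : ∀ i → UniversalPair (leader i) (partner i)
      leaders-Adj    : ∀ {i j} → i ≢ j → Adj (leader i) (leader j)

    open UniversalPair using (distinct; nonadjacent)

    member : Fin k → Fin 2 → Fin n
    member i 0F = leader i
    member i 1F = partner i

    private variable
      i j : Fin k

    member-universalPair : ∀ i s → ∃ (UniversalPair (member i s))
    member-universalPair i 0F = partner i , universalPair i
    member-universalPair i 1F = leader i , UniversalPair-swap (universalPair i)

    member-Adj-leader : i ≢ j → ∀ s → Adj (member i s) (leader j)
    member-Adj-leader i≢j 0F = leaders-Adj i≢j
    member-Adj-leader {i} {j} i≢j 1F =
      Adj-sym (UniversalPairs-Adj (universalPair j) (universalPair i) (leaders-Adj (i≢j ∘ sym)))

    member-Adj : i ≢ j → ∀ s t → Adj (member i s) (member j t)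
    member-Adj i≢j s 0F = member-Adj-leader i≢j s
    member-Adj {i} {j} i≢j s 1F =
      UniversalPairs-Adj (proj₂ (member-universalPair i s)) (universalPair j) (member-Adj-leader i≢j s)

    member-≁ : ∀ i s t → ¬ Adj (member i s) (member i t)
    member-≁ i 0F 0F = Adj-irrefl
    member-≁ i 0F 1F = nonadjacent (universalPair i)
    member-≁ i 1F 0F = nonadjacent (universalPair i) ∘ Adj-sym
    member-≁ i 1F 1F = Adj-irrefl

    member-Adj⇔ : ∀ ((i , s) (j , t) : Fin k × Fin 2) → Adj (member i s) (member j t) ⇔ i ≢ j
    member-Adj⇔ (i , s) (j , t) = mk⇔ (λ { e refl → member-≁ i s t e }) (λ i≢j → member-Adj i≢j s t)

    member-injective : ∀ ((i , s) (j , t) : Fin k × Fin 2) → member i s ≡ member j t → (i , s) ≡ (j , t)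
    member-injective (i , s) (j , t) eq with i ≟ᶠ j
    ... | no i≢j = contradiction (subst (Adj (member i s)) (sym eq) (member-Adj i≢j s t)) Adj-irrefl
    member-injective (i , 0F) (_ , 0F) eq | yes refl = refl
    member-injective (i , 0F) (_ , 1F) eq | yes refl = contradiction (sym eq) (distinct (universalPair i))
    member-injective (i , 1F) (_ , 0F) eq | yes refl = contradiction eq (distinct (universalPair i))
    member-injective (i , 1F) (_ , 1F) eq | yes refl = refl

    member-cover : ¬ (∀ i → Adj (leader i) z) → ∃[ i ] ∃[ s ] member i s ≡ z
    member-cover {z} notAll with ¬∀⟶∃¬ k (λ i → Adj (leader i) z) (λ i → adj? (leader i) z) notAll
    ... | i , leader≁z with UniversalPair-≁ (universalPair i) leader≁z
    ...   | inj₁ z≡leader  = i , 0F , sym z≡leader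
    ...   | inj₂ z≡partner = i , 1F , sym z≡partner

    pairVertex : Fin (sum (replicate k 2)) → Fin n
    pairVertex = uncurry member ∘ blockIndex k 2

    pairVertex-injective : ∀ {i j} → pairVertex i ≡ pairVertex j → i ≡ j
    pairVertex-injective {i} {j} eq = begin
      i                                    ≡⟨ blockSlot-blockIndex k 2 i ⟨
      uncurry blockSlot (blockIndex k 2 i) ≡⟨ cong (uncurry blockSlot) (member-injective _ _ eq) ⟩
      uncurry blockSlot (blockIndex k 2 j) ≡⟨ blockSlot-blockIndex k 2 j ⟩
      j                                    ∎
      where open ≡-Reasoning

    pairVertex-blockSlot : ∀ i s → pairVertex (blockSlot i s) ≡ member i s
    pairVertex-blockSlot i s = cong (uncurry member) (blockIndex-blockSlot i s)

    pairVertex-Adj⇔ : ∀ i j → Adj (pairVertex i) (pairVertex j) ⇔ part (replicate k 2) i ≢ part (replicate k 2) j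
    pairVertex-Adj⇔ i j = mk⇔
      (λ adj → Equivalence.to members adj ∘ Equivalence.to blocks)
      (λ notSame → Equivalence.from members (notSame ∘ Equivalence.from blocks))
      where
      members : Adj (pairVertex i) (pairVertex j) ⇔ proj₁ (blockIndex k 2 i) ≢ proj₁ (blockIndex k 2 j)
      members = member-Adj⇔ (blockIndex k 2 i) (blockIndex k 2 j)
      blocks : part (replicate k 2) i ≡ part (replicate k 2) j ⇔ proj₁ (blockIndex k 2 i) ≡ proj₁ (blockIndex k 2 j)
      blocks = samePart⇔sameBlock k 2 i j

    pairVertex-onto : ¬ (∀ i → Adj (leader i) z) → ∃[ j ] pairVertex j ≡ z
    pairVertex-onto notAll = let i , s , member≡z = member-cover notAll
                             in blockSlot i s , trans (pairVertex-blockSlot i s) member≡z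

    pairClique⇒≅K : (∀ z → ¬ (∀ i → Adj (leader i) z)) → G ≅ K (replicate k 2)
    pairClique⇒≅K notAll =
      enumeration⇒≅K (replicate k 2) pairVertex pairVertex-injective (pairVertex-onto ∘ notAll) pairVertex-Adj⇔

    pairClique+hub⇒≅K : ∀ h → ¬ InUniversalPair h → (∀ z → z ≢ h → ¬ (∀ i → Adj (leader i) z)) →
                        G ≅ K (1 ∷ replicate k 2)
    pairClique+hub⇒≅K h h-unpaired notAll = enumeration⇒≅K (1 ∷ replicate k 2) vertex injective onto adjacency
      where
      vertex : Fin (suc (sum (replicate k 2))) → Fin n
      vertex zero    = h
      vertex (suc j) = pairVertex j
      h-Adj : ∀ j → Adj h (pairVertex j)
      h-Adj j = let i , s = blockIndex k 2 j
                in Adj-sym (UniversalPair⇒Adj-unpaired (proj₂ (member-universalPair i s)) h-unpaired)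
      injective : ∀ {i j} → vertex i ≡ vertex j → i ≡ j
      injective {zero}  {zero}  _  = refl
      injective {zero}  {suc j} eq = contradiction (subst (Adj h) (sym eq) (h-Adj j)) Adj-irrefl
      injective {suc i} {zero}  eq = contradiction (subst (Adj h) eq (h-Adj i)) Adj-irrefl
      injective {suc i} {suc j} eq = cong suc (pairVertex-injective eq)
      onto : ∀ z → ∃[ j ] vertex j ≡ z
      onto z with z ≟ᶠ h
      ... | yes refl = zero , refl
      ... | no z≢h   = let j , eq = pairVertex-onto (notAll z z≢h) in suc j , eq
      adjacency : ∀ i j → Adj (vertex i) (vertex j) ⇔ part (1 ∷ replicate k 2) i ≢ part (1 ∷ replicate k 2) j
      adjacency zero    zero    = mk⇔ (⊥-elim ∘ Adj-irrefl) (contradiction refl)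
      adjacency zero    (suc j) = mk⇔ (λ _ ()) (λ _ → h-Adj j)
      adjacency (suc i) zero    = mk⇔ (λ _ ()) (λ _ → Adj-sym (h-Adj i))
      adjacency (suc i) (suc j) = mk⇔ (λ adj → Equivalence.to (pairVertex-Adj⇔ i j) adj ∘ suc-injective)
                                      (λ notSame → Equivalence.from (pairVertex-Adj⇔ i j) (notSame ∘ cong suc))

  unpaired-independent⇒twins : (∀ {a b} → ¬ InUniversalPair a → ¬ InUniversalPair b → ¬ Adj a b) →
                               ¬ InUniversalPair a → ¬ InUniversalPair b → Twins a b
  unpaired-independent⇒twins independent a-unpaired b-unpaired =
    transfer a-unpaired b-unpaired , transfer b-unpaired a-unpaired
    where
    transfer : ¬ InUniversalPair a → ¬ InUniversalPair b → Adj a x → Adj b x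
    transfer {x = x} a-unpaired b-unpaired a∼x with inUniversalPair? x
    ... | yes (_ , ux)  = Adj-sym (UniversalPair⇒Adj-unpaired ux b-unpaired)
    ... | no x-unpaired = contradiction a∼x (independent a-unpaired x-unpaired)

  onlyTwoUnpaired⇒UniversalPair : y ≢ x → ¬ Adj x y → (∀ z → z ≢ x → z ≢ y → InUniversalPair z) →
                                  ¬ InUniversalPair x → ¬ InUniversalPair y → UniversalPair x y
  onlyTwoUnpaired⇒UniversalPair y≢x x≁y othersPaired x-unpaired y-unpaired = record
    { distinct = y≢x ; nonadjacent = x≁y
    ; adjacentˡ = λ z≢x z≢y → Adj-sym (UniversalPair⇒Adj-unpaired (proj₂ (othersPaired _ z≢x z≢y)) x-unpaired)
    ; adjacentʳ = λ z≢x z≢y → Adj-sym (UniversalPair⇒Adj-unpaired (proj₂ (othersPaired _ z≢x z≢y)) y-unpaired) }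

  emptyPairClique : PairClique 0
  emptyPairClique = record { leader = λ () ; partner = λ () ; universalPair = λ () ; leaders-Adj = λ { {()} } }

  extend : (P : PairClique k) → UniversalPair x x′ → (∀ i → Adj x (PairClique.leader P i)) → PairClique (suc k)
  extend {x = x} {x′} P ux x∼leaders = record
    { leader        = x Vec.∷ leader
    ; partner       = x′ Vec.∷ partner
    ; universalPair = universalPair′
    ; leaders-Adj   = leaders-Adj′
    }
    where
    open PairClique P
    universalPair′ : ∀ i → UniversalPair ((x Vec.∷ leader) i) ((x′ Vec.∷ partner) i)
    universalPair′ zero    = ux
    universalPair′ (suc i) = universalPair i
    leaders-Adj′ : ∀ {i j} → i ≢ j → Adj ((x Vec.∷ leader) i) ((x Vec.∷ leader) j)
    leaders-Adj′ {zero}  {zero}  0≢0 = contradiction refl 0≢0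
    leaders-Adj′ {zero}  {suc j} _   = x∼leaders j
    leaders-Adj′ {suc i} {zero}  _   = Adj-sym (x∼leaders i)
    leaders-Adj′ {suc i} {suc j} i≢j = leaders-Adj (i≢j ∘ cong suc)

  grow : (∀ z → InUniversalPair z) → (P : PairClique k) →
         (∀ z → ¬ (∀ i → Adj (PairClique.leader P i) z)) ⊎ PairClique (suc k)
  grow paired P with any? (λ z → all? λ i → adj? (PairClique.leader P i) z)
  ... | no none         = inj₁ λ z all → none (z , all)
  ... | yes (z , z-adj) = inj₂ (extend P (proj₂ (paired z)) (λ i → Adj-sym (z-adj i)))

  Exceptional : Set
  Exceptional = (G ≅ K (1 ∷ 2 ∷ 2 ∷ [])) ⊎ (G ≅ K (2 ∷ 2 ∷ 2 ∷ [])) ⊎ (G ≅ K (2 ∷ 2 ∷ 2 ∷ 2 ∷ []))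

  someOther : x ≢ y → ∀ v → ∃[ z ] v ≢ z
  someOther {x} {y} x≢y v with v ≟ᶠ x
  ... | yes refl = y , x≢y
  ... | no v≢x   = x , v≢x

  module _ (diam : Diameter≤2) (locallyConnected : LocallyConnected G) where

    neighbour : x ≢ y → ∃[ z ] Adj x z
    neighbour {x} {y} x≢y with diam x y
    ... | 0 , _ , w              = contradiction (walk₀⇒≡ w) x≢y
    ... | suc _ , _ , step x∼z _ = _ , x∼z

    leaf⇒twoVertices : Adj x y → (∀ {z} → Adj x z → z ≡ y) → ∀ z → z ≡ x ⊎ z ≡ y
    leaf⇒twoVertices {x} {y} x∼y leaf z with diam x z
    ... | 0 , _ , w = inj₁ (sym (walk₀⇒≡ w))
    ... | 1 , _ , w = inj₂ (leaf (walk₁⇒Adj w))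
    ... | 2 , _ , step x∼m (step m∼z (stop _)) = inj₁ (onlyNeighbour (subst (flip Adj z) (leaf x∼m) m∼z))
      where
      onlyNeighbour : Adj y z → z ≡ x
      onlyNeighbour y∼z with z ≟ᶠ x
      ... | yes z≡x = z≡x
      ... | no z≢x  = let u , y∼u , x∼u = edge-inTriangle locallyConnected (Adj-sym x∼y) y∼z (z≢x ∘ sym)
                      in contradiction (subst (Adj y) (leaf x∼u) y∼u) Adj-irrefl
    ... | suc (suc (suc _)) , s≤s (s≤s ()) , _

    inTriangle : x ≢ y → ¬ Adj x y → ∀ v → ∃[ p ] ∃[ q ] (Adj v p × Adj v q × Adj p q)
    inTriangle {x} {y} x≢y x≁y v with neighbour (proj₂ (someOther x≢y v))
    ... | p , v∼p with any? (λ q → adj? v q ×-dec ¬? (q ≟ᶠ p))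
    ...   | yes (q , v∼q , q≢p) = let r , v∼r , p∼r = edge-inTriangle locallyConnected v∼p v∼q (q≢p ∘ sym)
                                  in p , r , v∼p , v∼r , p∼r
    ...   | no onlyP with leaf⇒twoVertices v∼p leaf x | leaf⇒twoVertices v∼p leaf y
      where
      leaf : Adj v z → z ≡ p
      leaf {z} v∼z with z ≟ᶠ p
      ... | yes z≡p = z≡p
      ... | no z≢p  = contradiction (z , v∼z , z≢p) onlyP
    ...     | inj₁ refl | inj₁ refl = contradiction refl x≢y
    ...     | inj₂ refl | inj₂ refl = contradiction refl x≢y
    ...     | inj₁ refl | inj₂ refl = contradiction v∼p x≁y
    ...     | inj₂ refl | inj₁ refl = contradiction (Adj-sym v∼p) x≁y

    noUniversalNeighbour⇒¬FewerLinesThan : x ≢ y → ¬ Adj x y → ∀ v →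
      (∀ {a} → Adj v a → ¬ UniversalPair a (rep a)) → ¬ FewerLinesThan G n
    noUniversalNeighbour⇒¬FewerLinesThan x≢y x≁y v noUniversal with inTriangle x≢y x≁y v
    ... | p , p′ , v∼p , v∼p′ , p∼p′ =
      Distinct.¬FewerLinesThan v∼p p∼p′ v∼p v∼p′ (Adj⇒≢ p∼p′)
        (centreEdge-≉ p∼p′ v∼p v∼p′ (λ v∼a ua _ _ → noUniversal v∼a ua) (λ v∼a ua _ _ → noUniversal v∼a ua))
        (λ v∼a ua _ _ _ _ _ → noUniversal v∼a ua) diam
      where open LineAssignment locallyConnected v p p p′ p p′

    unpairedEdge⇒¬FewerLinesThan : UniversalPair x x′ → ¬ InUniversalPair y → ¬ InUniversalPair z → Adj y z →
                                   ¬ FewerLinesThan G n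
    unpairedEdge⇒¬FewerLinesThan {x} {y = y} {z} ux y-unpaired z-unpaired y∼z =
      Distinct.¬FewerLinesThan x∼y y∼z x∼y x∼z (Adj⇒≢ y∼z)
        (centreEdge-≉ y∼z x∼y x∼z universal-≉ (λ _ ua a≈y _ → unpaired-¬twin y-unpaired ua a≈y))
        (λ _ _ _ _ ub b≈y _ → unpaired-¬twin y-unpaired ub b≈y) diam
      where
      open LineAssignment locallyConnected x y y z y z
      x∼y : Adj x y
      x∼y = UniversalPair⇒Adj-unpaired ux y-unpaired
      x∼z : Adj x z
      x∼z = UniversalPair⇒Adj-unpaired ux z-unpaired
      universal-≉ : Adj x a → UniversalPair a (rep a) → ¬ Twins a y → ¬ OnLine y z ≐ OnLine a y
      universal-≉ _ ua _ = ≉-sym (edgeLine-≉-via-commonNeighbour (UniversalPair⇒Adj-unpaired ua y-unpaired)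
                                    (UniversalPair⇒Adj-unpaired ua z-unpaired) y∼z endʳ)

    threePairs⇒¬FewerLinesThan : UniversalPair x x′ → Adj x a → Adj x b → Adj a b →
                                 ¬ InUniversalPair y → Adj a y → Adj b y → ¬ FewerLinesThan G n
    threePairs⇒¬FewerLinesThan {x} {a = a} {b} {y} ux x∼a x∼b a∼b y-unpaired a∼y b∼y =
      Distinct.¬FewerLinesThan (UniversalPair⇒Adj-unpaired ux y-unpaired) a∼b x∼a x∼b (Adj⇒≢ a∼b)
        (centreEdge-≉ a∼b x∼a x∼b (λ _ _ _ → edgeLine-≉-via-commonNeighbour a∼b a∼y b∼y endʳ)
                                  (λ _ uc c≈y _ → unpaired-¬twin y-unpaired uc c≈y))
        (λ _ _ _ _ uc c≈y _ → unpaired-¬twin y-unpaired uc c≈y) diam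
      where open LineAssignment locallyConnected x y a b a b

    K₅⇒¬FewerLinesThan : (x : Fin 5 → Fin n) → (∀ i j → i ≢ j → Adj (x i) (x j)) → ¬ FewerLinesThan G n
    K₅⇒¬FewerLinesThan x clique =
      Distinct.¬FewerLinesThan (y-Adj 0F λ ()) (clique 2F 3F λ ()) (clique 0F 2F λ ()) (clique 0F 3F λ ())
        (Adj⇒≢ (clique 2F 4F λ ()))
        (centreEdge-≉ (clique 2F 4F λ ()) (clique 0F 2F λ ()) (clique 0F 4F λ ())
          (λ _ _ _ → edgeLine-≉-via-commonNeighbour (clique 2F 4F λ ()) (y-Adj 2F λ ()) (y-Adj 4F λ ()) endʳ)
          (λ _ _ _ → edgeLine-≉-via-commonNeighbour (clique 2F 4F λ ()) (clique 2F 3F λ ()) (clique 4F 3F λ ()) endʳ))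
        (λ _ _ _ _ _ _ → edgeLine-≉-via-commonNeighbour (clique 2F 3F λ ()) (y-Adj 2F λ ()) (y-Adj 3F λ ()) endʳ)
        diam
      where
      open LineAssignment locallyConnected (x 0F) (rep (x 1F)) (x 2F) (x 3F) (x 2F) (x 4F)
      y-Adj : ∀ i → i ≢ 1F → Adj (x i) (rep (x 1F))
      y-Adj i i≢1 = twin-Adjˡ (rep-twin (x 1F)) (clique i 1F i≢1)

    unpairedTwins⇒¬FewerLinesThan : UniversalPair x x′ → Adj x b → Adj b p →
      ¬ InUniversalPair p → ¬ InUniversalPair q → p ≢ q → Twins p q → rep p ≢ p → rep p ≢ q →
      ¬ FewerLinesThan G n
    unpairedTwins⇒¬FewerLinesThan {x} {b = b} {p} {q} ux x∼b b∼p p-unpaired q-unpaired p≢q p≈q r≢p r≢q =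
      Distinct.¬FewerLinesThan x∼p b∼p x∼b x∼p p≢q centre-≉
        (λ _ _ _ _ uc c≈p _ → unpaired-¬twin p-unpaired uc c≈p) diam
      where
      open LineAssignment locallyConnected x p b p p q
      x∼p : Adj x p
      x∼p = UniversalPair⇒Adj-unpaired ux p-unpaired
      x∼q : Adj x q
      x∼q = UniversalPair⇒Adj-unpaired ux q-unpaired
      r∉pq : ¬ OnLine p q (rep p)
      r∉pq = nonEdgeLine-∌-nonNeighbour (twins⇒≁ p≈q) r≢p r≢q (twins⇒≁ (rep-twin p))
      centre-≉ : (r : Role a) → a ≢ x → ¬ OnLine p q ≐ ℓ (lineOf r)
      centre-≉ centre a≢x = contradiction refl a≢x
      centre-≉ (spoke a≢x _) _ = ≉-by-transfer endˡ r∉pq (spokeLine-twin a≢x x∼p (rep-twin p))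
      centre-≉ {a} (crowded _ _ a≈c c≢a c≢rep) _ with twins? a p
      ... | yes a≈p = ≉-sym (≉-by (subst (OnLine a (rep a)) (rep-cong a≈p) endʳ) r∉pq)
      ... | no ¬a≈p = ≉-sym (twinLine-≉-transfer a≈c c≢a c≢rep
                        (OnLine-twin a≈c (twin-≢ ≐-refl ¬a≈p) (twin-≢ ≐-refl ¬a≈q)
                                         (twin-≢ a≈c ¬a≈p) (twin-≢ a≈c ¬a≈q)))
        where
        ¬a≈q : ¬ Twins a q
        ¬a≈q = ¬a≈p ∘ flip ≐-trans (≐-sym p≈q)
      centre-≉ {a} (witnessed _ notRep noThird a≁z ¬a≈z _) _ with twins? a p
      ... | yes a≈p = ⊥-elim (NoThirdTwin-¬three noThird a≈p (≐-trans a≈p p≈q) (≐-trans a≈p (rep-twin p))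
                                                 p≢q r≢p r≢q)
      ... | no ¬a≈p = ≉-sym (nonTwinLine-≉-transfer notRep a≁z ¬a≈z
                        (OnLine-twin (rep-twin a) (twin-≢ ≐-refl ¬a≈p) (twin-≢ ≐-refl ¬a≈q)
                                                  (twin-≢ (rep-twin a) ¬a≈p) (twin-≢ (rep-twin a) ¬a≈q)))
        where
        ¬a≈q : ¬ Twins a q
        ¬a≈q = ¬a≈p ∘ flip ≐-trans (≐-sym p≈q)
      centre-≉ (universal x∼a ua _) _ =
        ≉-by (between (twins⇒≁ p≈q) (Adj-sym x∼p) (Adj-sym x∼q))
             (edgeLine-∌-commonNeighbour (UniversalPair⇒Adj-unpaired ua p-unpaired) (Adj⇒≢ x∼a) (Adj⇒≢ x∼p)
                             (Adj-sym x∼a) (Adj-sym x∼p))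
      centre-≉ (yTwin _ ua a≈p) _ = ⊥-elim (unpaired-¬twin p-unpaired ua a≈p)

    threeUnpairedTwins⇒¬FewerLinesThan : UniversalPair x x′ → Adj x b → (∀ {a} → ¬ InUniversalPair a → Adj b a) →
      ¬ InUniversalPair p → ¬ InUniversalPair q → ¬ InUniversalPair z → Twins p q → Twins p z →
      p ≢ q → p ≢ z → q ≢ z → ¬ FewerLinesThan G n
    threeUnpairedTwins⇒¬FewerLinesThan {b = b} {p} {q} {z} ux x∼b b∼unpaired p-unp q-unp z-unp p≈q p≈z p≢q p≢z q≢z
      with rep p ≟ᶠ p | rep p ≟ᶠ q
    ... | yes rep≡p | _ = unpairedTwins⇒¬FewerLinesThan ux x∼b (b∼unpaired q-unp) q-unp z-unp q≢z q≈z
                            (p≢q ∘ trans (sym rep≡p) ∘ trans (rep-cong p≈q))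
                            (p≢z ∘ trans (sym rep≡p) ∘ trans (rep-cong p≈q))
      where
      q≈z : Twins q z
      q≈z = ≐-trans (≐-sym p≈q) p≈z
    ... | no rep≢p | yes rep≡q = unpairedTwins⇒¬FewerLinesThan ux x∼b (b∼unpaired p-unp) p-unp z-unp p≢z p≈z rep≢p
                                   (λ rep≡z → q≢z (trans (sym rep≡q) rep≡z))
    ... | no rep≢p | no rep≢q  =
      unpairedTwins⇒¬FewerLinesThan ux x∼b (b∼unpaired p-unp) p-unp q-unp p≢q p≈q rep≢p rep≢q

    pairClique₂-commonNeighbour : (P : PairClique 2) → ∃[ z ] (∀ i → Adj (PairClique.leader P i) z)
    pairClique₂-commonNeighbour P with edge-inTriangle locallyConnected (leaders-Adj 0≢1) (member-Adj 0≢1 0F 1F)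
                                                        (UniversalPair.distinct (universalPair 1F) ∘ sym)
      where open PairClique P
            0≢1 : 0F ≢ 1F
            0≢1 ()
    ... | z , x∼z , y∼z = z , λ { 0F → x∼z ; 1F → y∼z }

    allPaired⇒≅K : FewerLinesThan G n → (∀ z → InUniversalPair z) → PairClique 2 →
                   (G ≅ K (2 ∷ 2 ∷ 2 ∷ [])) ⊎ (G ≅ K (2 ∷ 2 ∷ 2 ∷ 2 ∷ []))
    allPaired⇒≅K few paired P₂ with grow paired P₂
    ... | inj₁ notSpanned = ⊥-elim (uncurry notSpanned (pairClique₂-commonNeighbour P₂))
    ... | inj₂ P₃ with grow paired P₃
    ...   | inj₁ notSpanned = inj₁ (PairClique.pairClique⇒≅K P₃ notSpanned)
    ...   | inj₂ P₄ with grow paired P₄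
    ...     | inj₁ notSpanned = inj₂ (PairClique.pairClique⇒≅K P₄ notSpanned)
    ...     | inj₂ P₅ = ⊥-elim (K₅⇒¬FewerLinesThan (PairClique.leader P₅) (λ _ _ → PairClique.leaders-Adj P₅) few)

    independentUnpaired⇒≅K₁₂₂ : FewerLinesThan G n → (P : PairClique 2) →
      (∀ {a b} → ¬ InUniversalPair a → ¬ InUniversalPair b → ¬ Adj a b) →
      (∀ z → InUniversalPair z → ¬ (∀ i → Adj (PairClique.leader P i) z)) →
      ¬ InUniversalPair w → G ≅ K (1 ∷ 2 ∷ 2 ∷ [])
    independentUnpaired⇒≅K₁₂₂ {w} few P independent noThirdPair w-unp
      with any? (λ w₁ → ¬? (inUniversalPair? w₁) ×-dec ¬? (w₁ ≟ᶠ w))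
    ... | no onlyW = pairClique+hub⇒≅K w w-unp notSpanned
      where
      open PairClique P
      notSpanned : ∀ z → z ≢ w → ¬ (∀ i → Adj (leader i) z)
      notSpanned z z≢w with inUniversalPair? z
      ... | yes z-paired = noThirdPair z z-paired
      ... | no z-unp     = λ _ → onlyW (z , z-unp , z≢w)
    ... | yes (w₁ , w₁-unp , w₁≢w) with any? (λ w₂ → ¬? (inUniversalPair? w₂) ×-dec ¬? (w₂ ≟ᶠ w) ×-dec ¬? (w₂ ≟ᶠ w₁))
    ...   | no onlyTwo = ⊥-elim (w-unp (w₁ , onlyTwoUnpaired⇒UniversalPair w₁≢w (independent w-unp w₁-unp)
                                                othersPaired w-unp w₁-unp))
      where
      othersPaired : ∀ z → z ≢ w → z ≢ w₁ → InUniversalPair z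
      othersPaired z z≢w z≢w₁ = decidable-stable (inUniversalPair? z) (λ z-unp → onlyTwo (z , z-unp , z≢w , z≢w₁))
    ...   | yes (w₂ , w₂-unp , w₂≢w , w₂≢w₁) =
      ⊥-elim (threeUnpairedTwins⇒¬FewerLinesThan (universalPair 0F) (leaders-Adj λ ())
                (UniversalPair⇒Adj-unpaired (universalPair 1F)) w-unp w₁-unp w₂-unp
                (twins w-unp w₁-unp) (twins w-unp w₂-unp) (w₁≢w ∘ sym) (w₂≢w ∘ sym) (w₂≢w₁ ∘ sym) few)
      where
      open PairClique P
      twins : ¬ InUniversalPair a → ¬ InUniversalPair b → Twins a b
      twins = unpaired-independent⇒twins independent

    twoPairs⇒Exceptional : FewerLinesThan G n → PairClique 2 → Exceptional
    twoPairs⇒Exceptional few P with all? inUniversalPair?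
    ... | yes paired = inj₂ (allPaired⇒≅K few paired P)
    ... | no notAllPaired with ¬∀⟶∃¬ n InUniversalPair inUniversalPair? notAllPaired
    ...   | w , w-unp
      with any? (λ a → ¬? (inUniversalPair? a) ×-dec any? (λ b → ¬? (inUniversalPair? b) ×-dec adj? a b))
    ...     | yes (a , a-unp , b , b-unp , a∼b) =
      ⊥-elim (unpairedEdge⇒¬FewerLinesThan (PairClique.universalPair P 0F) a-unp b-unp a∼b few)
    ...     | no noEdge with any? (λ z → inUniversalPair? z ×-dec adj? (PairClique.leader P 0F) z
                                                        ×-dec adj? (PairClique.leader P 1F) z)
    ...       | yes (z , (_ , uz) , x∼z , y∼z) =
      ⊥-elim (threePairs⇒¬FewerLinesThan (universalPair 0F) (leaders-Adj λ ()) x∼z y∼z w-unp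
                (UniversalPair⇒Adj-unpaired (universalPair 1F) w-unp) (UniversalPair⇒Adj-unpaired uz w-unp) few)
      where open PairClique P
    ...       | no noThirdPair =
      inj₁ (independentUnpaired⇒≅K₁₂₂ few P (λ a-unp b-unp a∼b → noEdge (_ , a-unp , _ , b-unp , a∼b))
              (λ z z-paired adj → noThirdPair (z , z-paired , adj 0F , adj 1F)) w-unp)

    fewerLines⇒Exceptional : x ≢ y → ¬ Adj x y → FewerLinesThan G n → Exceptional
    fewerLines⇒Exceptional {x} x≢y x≁y few with any? inUniversalPair?
    ... | no nonePaired =
      ⊥-elim (noUniversalNeighbour⇒¬FewerLinesThan x≢y x≁y x (λ {a} _ ua → nonePaired (a , rep a , ua)) few)
    ... | yes (u , u′ , uu) with any? (λ v → inUniversalPair? v ×-dec adj? u v)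
    ...   | no noPairedNeighbour =
      ⊥-elim (noUniversalNeighbour⇒¬FewerLinesThan x≢y x≁y u
                (λ {a} u∼a ua → noPairedNeighbour (a , (rep a , ua) , u∼a)) few)
    ...   | yes (v , (v′ , uv) , u∼v) =
      twoPairs⇒Exceptional few (extend (extend emptyPairClique uv λ ()) uu λ { 0F → u∼v })


proposition2p4 : (n : ℕ) (G : Graph n) → Connected G → LocallyConnected G → DiameterTwo G →
    FewerLinesThan G n →
    (G ≅ K (1 ∷ 2 ∷ 2 ∷ [])) ⊎ (G ≅ K (2 ∷ 2 ∷ 2 ∷ [])) ⊎ (G ≅ K (2 ∷ 2 ∷ 2 ∷ 2 ∷ []))
proposition2p4 n G _ locallyConnected (diam , x , y , far) =
  fewerLines⇒Exceptional G diam locallyConnected x≢y x≁y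
  where
  x≢y : x ≢ y
  x≢y refl with far (stop x)
  ... | ()
  x≁y : ¬ Graph.Adj G x y
  x≁y x∼y with far (step x∼y (stop y))
  ... | s≤s ()
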